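{- Let $n \geq 2$ and $t \geq 2$ be integers, let $p$ be a prime, and let $V$ be a line (one-dimensional subspace) in $\mathbb{Z}_p^n$. Then there exists a nonzero $(\bar{a}_1,\dots,\bar{a}_n) \in V$ such that either $0 \leq a_i \leq 2 n t p^{(n-1)/n}$ for all $1 \leq i \leq n$, or $|\bar{a}_i|_p \leq 8nt^{ -1/(n-1)}p^{(n-1)/n}$ for all $1 \leq i \leq n$.
   Context: For $\bar a\in\mathbb{Z}_p$, $a$ denotes its least nonnegative integer representative ($0\le a<p$), and $|\bar a|_p=\min(a,p-a)$. -}

module Defs where

open import Data.Nat using (ℕ; _*_; _∸_; _⊓_; NonZero)
open import Data.Nat.DivMod using (_mod_)
open import Data.Fin using (Fin; toℕ)
open import Data.Product using (∃; Σ; _,_)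
open import Relation.Binary.PropositionalEquality using (_≡_; _≢_)

-- Z_p is represented by Fin p (residue a ∈ Fin p, with least nonnegative
-- representative toℕ a, 0 ≤ toℕ a < p).  Vectors of Z_p^n: Fin n → Fin p.
ZpVec : (p n : ℕ) → Set
ZpVec p n = Fin n → Fin p

_·ᵥ_ : ∀ {p n} .{{_ : NonZero p}} → Fin p → ZpVec p n → ZpVec p n
(_·ᵥ_ {p} c v) i = (toℕ c * toℕ (v i)) mod p

NonzeroVec : ∀ {p n} → ZpVec p n → Set
NonzeroVec {n = n} v = ∃ λ (i : Fin n) → toℕ (v i) ≢ 0

InLine : ∀ {p n} .{{_ : NonZero p}} → ZpVec p n → ZpVec p n → Set
InLine {p} {n} d w = ∃ λ (c : Fin p) → ∀ (i : Fin n) → w i ≡ (c ·ᵥ d) i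

absp : (p : ℕ) → Fin p → ℕ
absp p a = toℕ a ⊓ (p ∸ toℕ a)

module Submission where

-- If p ≤ (2nt)^n the spanning vector d already satisfies the first bound.
-- Otherwise we use a pigeonhole argument.  Split [0, p) into K cells of length
-- p/K and label every scalar c ∈ Z_p by the cells of the coordinates of c·d:
-- the block ⌊q₀/M⌋ of the first cell, and the offsets q_i - q₀ of the others.
-- With fewer than p labels, two scalars c ≠ c' collide; then the cells of c'·d
-- are those of c·d shifted by some δ < M, and a = (c' - c)·d has all
-- coordinates below M·p/K (δ ≥ 1) or all of absolute value below p/K (δ = 0).
-- Taking R ≈ p^(1/n), S ≈ t^(1/(n-1)), K ≈ RS/8n, M ≈ 2ntK/R and A ≈ K/M
-- makes the label count A·(2K)^(n-1) smaller than p and turns the two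
-- alternatives into the two bounds of the theorem.

open import Defs
open import Data.Nat
open import Data.Nat.Properties
open import Data.Nat.DivMod using (_%_; _/_; _mod_; m≡m%n+[m/n]*n; m%n<n; m/n*n≤m; m%n%n≡m%n;
  m<n⇒m%n≡m; [m+n]%n≡m%n; %-distribˡ-+; %-distribˡ-*; m<n*o⇒m/o<n; m≥n⇒m/n>0)
open import Data.Nat.Divisibility using (_∣_; m%n≡0⇒n∣m; ∣⇒≤)
open import Data.Nat.Primality using (Prime; euclidsLemma; prime⇒nonTrivial)
open import Data.Nat.Solver using (module +-*-Solver)
open import Data.Fin using (Fin; toℕ; fromℕ<; combine; funToFin; finToFun)
  renaming (zero to fzero; suc to fsuc)
open import Data.Fin.Properties using (toℕ<n; toℕ-fromℕ<; toℕ-injective; fromℕ<-injective;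
  combine-injective; finToFun-funToFin; pigeonhole) renaming (<⇒≢ to <ᶠ⇒≢)
open import Data.Product using (∃; _×_; _,_)
open import Data.Sum using (_⊎_; inj₁; inj₂; [_,_])
open import Data.Empty using (⊥-elim)
open import Relation.Binary.PropositionalEquality hiding ([_])
open import Relation.Nullary using (¬_; yes; no)
open +-*-Solver

^-distribʳ-* : ∀ a b k → (a * b) ^ k ≡ a ^ k * b ^ k
^-distribʳ-* a b zero    = refl
^-distribʳ-* a b (suc k) = begin
  a * b * (a * b) ^ k      ≡⟨ cong (a * b *_) (^-distribʳ-* a b k) ⟩
  a * b * (a ^ k * b ^ k)  ≡⟨ solve 4 (λ a b x y → a :* b :* (x :* y) := a :* x :* (b :* y))
                                refl a b (a ^ k) (b ^ k) ⟩
  a * a ^ k * (b * b ^ k)  ∎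
  where open ≡-Reasoning

iroot : ∀ k .{{_ : NonZero k}} x → ∃ λ r → r ^ k ≤ x × x < suc r ^ k
iroot k@(suc _) zero = 0 , z≤n , m^n>0 1 k
iroot k (suc x) with iroot k x
... | r , r^k≤x , x<[1+r]^k with suc x <? suc r ^ k
...   | yes 1+x<[1+r]^k = r , m≤n⇒m≤1+n r^k≤x , 1+x<[1+r]^k
...   | no  1+x≮[1+r]^k = suc r , ≤-reflexive [1+r]^k≡1+x ,
                            subst (_< suc (suc r) ^ k) [1+r]^k≡1+x (^-monoˡ-< k (n<1+n (suc r)))
  where
  [1+r]^k≡1+x : suc r ^ k ≡ suc x
  [1+r]^k≡1+x = ≤-antisym (≮⇒≥ 1+x≮[1+r]^k) x<[1+r]^k

root-positive : ∀ x r k → 1 < x → x < suc r ^ k → 1 ≤ r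
root-positive x zero    k 1<x x<1 = ⊥-elim (<⇒≱ (subst (x <_) (^-zeroˡ k) x<1) (<⇒≤ 1<x))
root-positive x (suc _) k _   _   = s≤s z≤n

[1+s]^k≤2^k*s^k : ∀ s k → 1 ≤ s → suc s ^ k ≤ 2 ^ k * s ^ k
[1+s]^k≤2^k*s^k s k 1≤s = begin
  suc s ^ k       ≤⟨ ^-monoˡ-≤ k (subst (suc s ≤_) (cong (s +_) (sym (+-identityʳ s))) (+-monoˡ-≤ s 1≤s)) ⟩
  (2 * s) ^ k     ≡⟨ ^-distribʳ-* 2 s k ⟩
  2 ^ k * s ^ k   ∎
  where open ≤-Reasoning

-- A Bernoulli-type estimate: (1 + 1/R)^k ≤ R/(R - k), cleared of denominators.
bernoulli : ∀ k m R → R ≡ m + k → suc R ^ k * m ≤ R ^ suc k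
bernoulli zero m R R≡m+0 = begin
  1 * m      ≡⟨ *-identityˡ m ⟩
  m          ≡⟨ sym (trans R≡m+0 (+-identityʳ m)) ⟩
  R          ≡⟨ sym (*-identityʳ R) ⟩
  R * 1      ∎
  where open ≤-Reasoning
bernoulli (suc k) m R R≡m+1+k = begin
  suc R * P * m    ≡⟨ solve 3 (λ a b c → a :* b :* c := b :* (a :* c)) refl (suc R) P m ⟩
  P * (suc R * m)  ≤⟨ *-monoʳ-≤ P [1+R]m≤[1+m]R ⟩
  P * (suc m * R)  ≡⟨ sym (*-assoc P (suc m) R) ⟩
  P * suc m * R    ≤⟨ *-monoˡ-≤ R (bernoulli k (suc m) R (trans R≡m+1+k (+-suc m k))) ⟩
  R ^ suc k * R    ≡⟨ *-comm (R ^ suc k) R ⟩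
  R ^ suc (suc k)  ∎
  where
  open ≤-Reasoning
  P = suc R ^ k
  [1+R]m≤[1+m]R : suc R * m ≤ suc m * R
  [1+R]m≤[1+m]R = begin
    m + R * m  ≤⟨ +-monoˡ-≤ (R * m) (subst (m ≤_) (sym R≡m+1+k) (m≤m+n m (suc k))) ⟩
    R + R * m  ≡⟨ cong (R +_) (*-comm R m) ⟩
    R + m * R  ∎

[1+r]^n≤2r^n : ∀ n r → 2 * n ≤ r → suc r ^ n ≤ 2 * r ^ n
[1+r]^n≤2r^n zero    r _     = s≤s z≤n
[1+r]^n≤2r^n n@(suc _) r@(suc _) 2n≤r = *-cancelʳ-≤ (suc r ^ n) (2 * r ^ n) r (begin
  suc r ^ n * r        ≤⟨ *-monoʳ-≤ (suc r ^ n) r≤2m ⟩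
  suc r ^ n * (2 * m)  ≡⟨ solve 3 (λ a b c → a :* (b :* c) := b :* (a :* c)) refl (suc r ^ n) 2 m ⟩
  2 * (suc r ^ n * m)  ≤⟨ *-monoʳ-≤ 2 (bernoulli n m r r≡m+n) ⟩
  2 * (r * r ^ n)      ≡⟨ solve 3 (λ a b c → a :* (b :* c) := a :* c :* b) refl 2 r (r ^ n) ⟩
  2 * r ^ n * r        ∎)
  where
  open ≤-Reasoning
  m = r ∸ n
  n+n≤r : n + n ≤ r
  n+n≤r = subst (_≤ r) (cong (n +_) (+-identityʳ n)) 2n≤r
  r≡m+n : r ≡ m + n
  r≡m+n = sym (m∸n+n≡m (≤-trans (m≤m+n n n) n+n≤r))
  r≤2m : r ≤ 2 * m
  r≤2m = begin
    r          ≡⟨ r≡m+n ⟩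
    m + n      ≤⟨ +-monoʳ-≤ m (+-cancelʳ-≤ n n m (subst (n + n ≤_) r≡m+n n+n≤r)) ⟩
    m + m      ≡⟨ cong (m +_) (sym (+-identityʳ m)) ⟩
    2 * m      ∎

m<[m/n]*n+n : ∀ m n .{{_ : NonZero n}} → m < m / n * n + n
m<[m/n]*n+n m n = begin-strict
  m                    ≡⟨ m≡m%n+[m/n]*n m n ⟩
  m % n + m / n * n    <⟨ +-monoˡ-< (m / n * n) (m%n<n m n) ⟩
  n + m / n * n        ≡⟨ +-comm n (m / n * n) ⟩
  m / n * n + n        ∎
  where open ≤-Reasoning

/-≡⇒close : ∀ {M} .{{_ : NonZero M}} a b → a ≤ b → a / M ≡ b / M → b < a + M
/-≡⇒close {M} a b a≤b a/M≡b/M = begin-strict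
  b                <⟨ m<[m/n]*n+n b M ⟩
  b / M * M + M    ≡⟨ cong (λ z → z * M + M) (sym a/M≡b/M) ⟩
  a / M * M + M    ≤⟨ +-monoˡ-≤ M (m/n*n≤m a M) ⟩
  a + M            ∎
  where open ≤-Reasoning

%-cong-+ : ∀ {m m' n n'} d .{{_ : NonZero d}} → m % d ≡ m' % d → n % d ≡ n' % d →
           (m + n) % d ≡ (m' + n') % d
%-cong-+ {m} {m'} {n} {n'} d m≡m' n≡n' = begin
  (m + n) % d              ≡⟨ %-distribˡ-+ m n d ⟩
  (m % d + n % d) % d      ≡⟨ cong₂ (λ a b → (a + b) % d) m≡m' n≡n' ⟩
  (m' % d + n' % d) % d    ≡⟨ %-distribˡ-+ m' n' d ⟨
  (m' + n') % d            ∎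
  where open ≡-Reasoning

%-congˡ-* : ∀ {m m'} n d .{{_ : NonZero d}} → m % d ≡ m' % d → (m * n) % d ≡ (m' * n) % d
%-congˡ-* {m} {m'} n d m≡m' = begin
  (m * n) % d              ≡⟨ %-distribˡ-* m n d ⟩
  (m % d * (n % d)) % d    ≡⟨ cong (λ a → (a * (n % d)) % d) m≡m' ⟩
  (m' % d * (n % d)) % d   ≡⟨ %-distribˡ-* m' n d ⟨
  (m' * n) % d             ∎
  where open ≡-Reasoning

toℕ-mod : ∀ {p} .{{_ : NonZero p}} m → toℕ (m mod p) ≡ m % p
toℕ-mod {p} m = toℕ-fromℕ< (m%n<n m p)

toℕ-mod-% : ∀ {p} .{{_ : NonZero p}} m → toℕ (m mod p) % p ≡ m % p
toℕ-mod-% {p} m = trans (cong (_% p) (toℕ-mod m)) (m%n%n≡m%n m p)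

toℕ-% : ∀ {p} .{{_ : NonZero p}} (c : Fin p) → toℕ c % p ≡ toℕ c
toℕ-% c = m<n⇒m%n≡m (toℕ<n c)

_⊖_ : ∀ {p} .{{_ : NonZero p}} → Fin p → Fin p → Fin p
_⊖_ {p} c' c = (toℕ c' + (p ∸ toℕ c)) mod p

⊖-+ : ∀ {p} .{{_ : NonZero p}} (c' c : Fin p) → (toℕ (c' ⊖ c) + toℕ c) % p ≡ toℕ c'
⊖-+ {p} c' c = begin
  (toℕ (c' ⊖ c) + toℕ c) % p            ≡⟨ %-cong-+ p (toℕ-mod-% (toℕ c' + (p ∸ toℕ c))) refl ⟩
  (toℕ c' + (p ∸ toℕ c) + toℕ c) % p    ≡⟨ cong (_% p) (+-assoc (toℕ c') (p ∸ toℕ c) (toℕ c)) ⟩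
  (toℕ c' + (p ∸ toℕ c + toℕ c)) % p    ≡⟨ cong (λ z → (toℕ c' + z) % p) (m∸n+n≡m (<⇒≤ (toℕ<n c))) ⟩
  (toℕ c' + p) % p                      ≡⟨ [m+n]%n≡m%n (toℕ c') p ⟩
  toℕ c' % p                            ≡⟨ toℕ-% c' ⟩
  toℕ c'                                ∎
  where open ≡-Reasoning

⊖≢0 : ∀ {p} .{{_ : NonZero p}} {c' c : Fin p} → c' ≢ c → toℕ (c' ⊖ c) ≢ 0
⊖≢0 {p} {c'} {c} c'≢c c'⊖c≡0 = c'≢c (toℕ-injective (begin
  toℕ c'                       ≡⟨ ⊖-+ c' c ⟨
  (toℕ (c' ⊖ c) + toℕ c) % p   ≡⟨ cong (λ z → (z + toℕ c) % p) c'⊖c≡0 ⟩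
  toℕ c % p                    ≡⟨ toℕ-% c ⟩
  toℕ c                        ∎))
  where open ≡-Reasoning

·ᵥ-⊖ : ∀ {p n} .{{_ : NonZero p}} (c' c : Fin p) (d : ZpVec p n) i →
       (toℕ (((c' ⊖ c) ·ᵥ d) i) + toℕ ((c ·ᵥ d) i)) % p ≡ toℕ ((c' ·ᵥ d) i)
·ᵥ-⊖ {p} c' c d i = begin
  (toℕ (((c' ⊖ c) ·ᵥ d) i) + toℕ ((c ·ᵥ d) i)) % p  ≡⟨ %-cong-+ p (toℕ-mod-% (s * x)) (toℕ-mod-% (toℕ c * x)) ⟩
  (s * x + toℕ c * x) % p                            ≡⟨ cong (_% p) (*-distribʳ-+ x s (toℕ c)) ⟨
  ((s + toℕ c) * x) % p                              ≡⟨ %-congˡ-* x p (trans (⊖-+ c' c) (sym (toℕ-% c'))) ⟩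
  (toℕ c' * x) % p                                   ≡⟨ toℕ-mod (toℕ c' * x) ⟨
  toℕ ((c' ·ᵥ d) i)                                  ∎
  where
  open ≡-Reasoning
  s = toℕ (c' ⊖ c)
  x = toℕ (d i)

%-lift : ∀ {p} .{{_ : NonZero p}} x u v → x < p → u < p → (x + u) % p ≡ v →
         x + u ≡ v ⊎ x + u ≡ v + p
%-lift {p} x u v x<p u<p x+u≡v with x + u <? p
... | yes x+u<p = inj₁ (trans (sym (m<n⇒m%n≡m x+u<p)) x+u≡v)
... | no  x+u≮p = inj₂ (begin
  x + u            ≡⟨ m∸n+n≡m p≤x+u ⟨
  x + u ∸ p + p    ≡⟨ cong (_+ p) (trans (sym (m<n⇒m%n≡m wrapped<p)) wrapped%p≡v) ⟩
  v + p            ∎)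
  where
  open ≡-Reasoning
  p≤x+u : p ≤ x + u
  p≤x+u = ≮⇒≥ x+u≮p
  wrapped<p : x + u ∸ p < p
  wrapped<p = +-cancelʳ-< p (x + u ∸ p) p
                (subst (_< p + p) (sym (m∸n+n≡m p≤x+u)) (+-mono-< x<p u<p))
  wrapped%p≡v : (x + u ∸ p) % p ≡ v
  wrapped%p≡v = trans (sym ([m+n]%n≡m%n (x + u ∸ p) p))
                      (trans (cong (_% p) (m∸n+n≡m p≤x+u)) x+u≡v)

·ᵥ-nonzero : ∀ {p n} .{{_ : NonZero p}} → Prime p → (c : Fin p) → toℕ c ≢ 0 →
             (d : ZpVec p n) → NonzeroVec d → NonzeroVec (c ·ᵥ d)
·ᵥ-nonzero {p} pp c c≢0 d (k , dₖ≢0) = k , λ cdₖ≡0 →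
  [ p∤ c≢0 , p∤ dₖ≢0 ] (euclidsLemma (toℕ c) (toℕ (d k)) pp
                          (m%n≡0⇒n∣m _ p (trans (sym (toℕ-mod _)) cdₖ≡0)))
  where
  p∤ : {x : Fin p} → toℕ x ≢ 0 → ¬ p ∣ toℕ x
  p∤ {x} x≢0 p∣x = <⇒≱ (toℕ<n x) (∣⇒≤ {{≢-nonZero x≢0}} p∣x)

-- Split [0, p) into K cells of length p/K; the cell of v is ⌊vK/p⌋.
module Cells (K p : ℕ) .{{_ : NonZero K}} .{{_ : NonZero p}} where

  cell : ℕ → ℕ
  cell v = v * K / p

  cell-lower : ∀ v → cell v * p ≤ v * K
  cell-lower v = m/n*n≤m (v * K) p

  cell-upper : ∀ v → v * K < cell v * p + p
  cell-upper v = m<[m/n]*n+n (v * K) p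

  cell<K : ∀ v → v < p → cell v < K
  cell<K v v<p = m<n*o⇒m/o<n (subst (v * K <_) (*-comm p K) (*-monoˡ-< K v<p))

  cell-<⇒< : ∀ v w → cell v < cell w → v < w
  cell-<⇒< v w cv<cw = *-cancelʳ-< K v w (begin-strict
    v * K                <⟨ cell-upper v ⟩
    cell v * p + p       ≡⟨ +-comm (cell v * p) p ⟩
    suc (cell v) * p     ≤⟨ *-monoˡ-≤ p cv<cw ⟩
    cell w * p           ≤⟨ cell-lower w ⟩
    w * K                ∎)
    where open ≤-Reasoning

  cell-gap : ∀ x v w δ → x + v ≡ w → cell w ≡ cell v + δ → x * K < suc δ * p
  cell-gap x v w δ x+v≡w cw≡cv+δ = +-cancelʳ-< (v * K) (x * K) (suc δ * p) (begin-strict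
    x * K + v * K          ≡⟨ *-distribʳ-+ K x v ⟨
    (x + v) * K            ≡⟨ cong (_* K) x+v≡w ⟩
    w * K                  <⟨ cell-upper w ⟩
    cell w * p + p         ≡⟨ cong (λ c → c * p + p) cw≡cv+δ ⟩
    (cell v + δ) * p + p   ≡⟨ cong (_+ p) (*-distribʳ-+ p (cell v) δ) ⟩
    cell v * p + δ * p + p ≡⟨ trans (+-assoc (cell v * p) (δ * p) p) (+-comm (cell v * p) (δ * p + p)) ⟩
    δ * p + p + cell v * p ≡⟨ cong (_+ cell v * p) (+-comm (δ * p) p) ⟩
    suc δ * p + cell v * p ≤⟨ +-monoʳ-≤ (suc δ * p) (cell-lower v) ⟩
    suc δ * p + v * K      ∎)
    where open ≤-Reasoning

  same-cell-gap : ∀ x v w → x + v ≡ w → cell v ≡ cell w → x * K < p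
  same-cell-gap x v w x+v≡w cv≡cw = subst (x * K <_) (*-identityˡ p)
    (cell-gap x v w 0 x+v≡w (trans (sym cv≡cw) (sym (+-identityʳ (cell v)))))

  same-cell⇒short : ∀ x v w → x < p → (x + v ≡ w ⊎ x + v ≡ w + p) → cell v ≡ cell w →
                    (x ⊓ (p ∸ x)) * K < p
  same-cell⇒short x v w x<p (inj₁ x+v≡w) cv≡cw =
    ≤-<-trans (*-monoˡ-≤ K (m⊓n≤m x (p ∸ x))) (same-cell-gap x v w x+v≡w cv≡cw)
  same-cell⇒short x v w x<p (inj₂ x+v≡w+p) cv≡cw =
    ≤-<-trans (*-monoˡ-≤ K (m⊓n≤n x (p ∸ x))) (same-cell-gap (p ∸ x) w v p-x+w≡v (sym cv≡cw))
    where
    p-x+w≡v : p ∸ x + w ≡ v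
    p-x+w≡v = +-cancelˡ-≡ x (p ∸ x + w) v (begin
      x + (p ∸ x + w)  ≡⟨ +-assoc x (p ∸ x) w ⟨
      x + (p ∸ x) + w  ≡⟨ cong (_+ w) (m+[n∸m]≡n (<⇒≤ x<p)) ⟩
      p + w            ≡⟨ +-comm p w ⟩
      w + p            ≡⟨ x+v≡w+p ⟨
      x + v            ∎)
      where open ≡-Reasoning

  -- If instead w's cell lies δ ≥ 1 cells above v's, no wrap-around is possible,
  -- and x itself is below (δ+1)·p/K.
  shifted-cell⇒small : ∀ x v w δ → x < p → (x + v ≡ w ⊎ x + v ≡ w + p) →
                       cell w ≡ cell v + δ → 1 ≤ δ → x * K < suc δ * p
  shifted-cell⇒small x v w δ x<p (inj₁ x+v≡w)   cw≡cv+δ 1≤δ = cell-gap x v w δ x+v≡w cw≡cv+δ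
  shifted-cell⇒small x v w δ x<p (inj₂ x+v≡w+p) cw≡cv+δ 1≤δ = ⊥-elim (<-asym v<w w<v)
    where
    cv<cw : cell v < cell w
    cv<cw = subst (cell v <_) (sym cw≡cv+δ)
                  (subst (_≤ cell v + δ) (+-comm (cell v) 1) (+-monoʳ-≤ (cell v) 1≤δ))
    v<w : v < w
    v<w = cell-<⇒< v w cv<cw
    w<v : w < v
    w<v = +-cancelʳ-< p w v (subst (_< v + p) x+v≡w+p
                               (subst (x + v <_) (+-comm p v) (+-monoˡ-< v x<p)))

offset-injective : ∀ K a b a' b' → b ≤ K + a → b' ≤ K + a' →
                   K + a ∸ b ≡ K + a' ∸ b' → a + b' ≡ a' + b
offset-injective K a b a' b' b≤K+a b'≤K+a' eq = +-cancelˡ-≡ K (a + b') (a' + b) (begin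
  K + (a + b')             ≡⟨ +-assoc K a b' ⟨
  K + a + b'               ≡⟨ cong (_+ b') (m∸n+n≡m b≤K+a) ⟨
  K + a ∸ b + b + b'       ≡⟨ solve 3 (λ x b b' → x :+ b :+ b' := x :+ b' :+ b) refl (K + a ∸ b) b b' ⟩
  K + a ∸ b + b' + b       ≡⟨ cong (λ z → z + b' + b) eq ⟩
  K + a' ∸ b' + b' + b     ≡⟨ cong (_+ b) (m∸n+n≡m b'≤K+a') ⟩
  K + a' + b               ≡⟨ +-assoc K a' b ⟩
  K + (a' + b)             ∎)
  where open ≡-Reasoning

balanced⇒shift : ∀ a b a' δ → a + (b + δ) ≡ a' + b → a' ≡ a + δ
balanced⇒shift a b a' δ eq = +-cancelʳ-≡ b a' (a + δ) (begin
  a' + b         ≡⟨ eq ⟨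
  a + (b + δ)    ≡⟨ cong (a +_) (+-comm b δ) ⟩
  a + (δ + b)    ≡⟨ +-assoc a δ b ⟨
  a + δ + b      ∎)
  where open ≡-Reasoning

CellResult : ∀ {p n} .{{_ : NonZero p}} → ZpVec p n → (K M : ℕ) → Set
CellResult {p} {n} d K M = ∃ λ (a : ZpVec p n) → InLine d a × NonzeroVec a ×
  ((∀ i → toℕ (a i) * K < M * p) ⊎ (∀ i → absp p (a i) * K < p))

-- Label each scalar c by the block ⌊q₀/M⌋ of the first cell of c·d and the
-- offsets q_{i+1} - q₀ of the other cells; there are A·(2K)^(n-1) < p labels, so two
-- scalars c ≠ c' share a label, their cells differ by a uniform shift δ < M, and
-- (c' ⊖ c)·d is the required vector.
module Pigeonhole {p : ℕ} .{{_ : NonZero p}} (p-prime : Prime p)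
                  {n₁ : ℕ} (d : ZpVec p (suc n₁)) (d≢0 : NonzeroVec d)
                  (K M A : ℕ) .{{_ : NonZero K}} .{{_ : NonZero M}}
                  (K≤AM : K ≤ A * M) (few-labels : A * (K + K) ^ n₁ < p) where

  open Cells K p

  q : Fin p → Fin (suc n₁) → ℕ
  q c i = cell (toℕ ((c ·ᵥ d) i))

  q<K : ∀ c i → q c i < K
  q<K c i = cell<K _ (toℕ<n ((c ·ᵥ d) i))

  block : Fin p → Fin A
  block c = fromℕ< (m<n*o⇒m/o<n (<-≤-trans (q<K c fzero) K≤AM))

  offset<2K : ∀ c i → K + q c (fsuc i) ∸ q c fzero < K + K
  offset<2K c i = ≤-<-trans (m∸n≤m (K + q c (fsuc i)) (q c fzero)) (+-monoʳ-< K (q<K c (fsuc i)))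

  offset : Fin p → Fin n₁ → Fin (K + K)
  offset c i = fromℕ< (offset<2K c i)

  label : Fin p → Fin (A * (K + K) ^ n₁)
  label c = combine (block c) (funToFin (offset c))

  Shift : Fin p → Fin p → ℕ → Set
  Shift c c' δ = δ < M × (∀ i → q c' i ≡ q c i + δ)

  Balanced : Fin p → Fin p → Set
  Balanced c c' = ∀ i → q c i + q c' fzero ≡ q c' i + q c fzero

  same-offsets⇒balanced : ∀ c c' → funToFin (offset c) ≡ funToFin (offset c') → Balanced c c'
  same-offsets⇒balanced c c' same fzero    = +-comm (q c fzero) (q c' fzero)
  same-offsets⇒balanced c c' same (fsuc i) = offset-injective K _ _ _ _
    (≤-trans (<⇒≤ (q<K c fzero)) (m≤m+n K _)) (≤-trans (<⇒≤ (q<K c' fzero)) (m≤m+n K _))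
    (fromℕ<-injective _ _ (offset<2K c i) (offset<2K c' i) (begin
      offset c i                         ≡⟨ finToFun-funToFin (offset c) i ⟨
      finToFun (funToFin (offset c)) i   ≡⟨ cong (λ f → finToFun f i) same ⟩
      finToFun (funToFin (offset c')) i  ≡⟨ finToFun-funToFin (offset c') i ⟩
      offset c' i                        ∎))
    where open ≡-Reasoning

  balanced⇒shift-by : ∀ c c' → Balanced c c' → q c fzero ≤ q c' fzero → block c ≡ block c' →
                      Shift c c' (q c' fzero ∸ q c fzero)
  balanced⇒shift-by c c' bal q₀≤q₀' same-block =
    +-cancelˡ-< q₀ δ M (subst (_< q₀ + M) q₀'≡q₀+δ (/-≡⇒close q₀ q₀' q₀≤q₀' same-q₀-block)) ,
    λ i → balanced⇒shift (q c i) q₀ (q c' i) δ (subst (λ z → q c i + z ≡ q c' i + q₀) q₀'≡q₀+δ (bal i))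
    where
    q₀ = q c fzero
    q₀' = q c' fzero
    δ = q₀' ∸ q₀
    q₀'≡q₀+δ : q₀' ≡ q₀ + δ
    q₀'≡q₀+δ = sym (m+[n∸m]≡n q₀≤q₀')
    same-q₀-block : q₀ / M ≡ q₀' / M
    same-q₀-block = fromℕ<-injective _ _ _ _ same-block

  same-label⇒shift : ∀ c c' → label c ≡ label c' → ∃ λ δ → Shift c c' δ ⊎ Shift c' c δ
  same-label⇒shift c c' same with combine-injective (block c) _ (block c') _ same
  ... | same-block , same-offsets with ≤-total (q c fzero) (q c' fzero)
  ...   | inj₁ q₀≤q₀' = _ , inj₁ (balanced⇒shift-by c c' bal q₀≤q₀' same-block)
    where bal = same-offsets⇒balanced c c' same-offsets
  ...   | inj₂ q₀'≤q₀ = _ , inj₂ (balanced⇒shift-by c' c (λ i → sym (bal i)) q₀'≤q₀ (sym same-block))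
    where bal = same-offsets⇒balanced c c' same-offsets

  -- A shift from c to c' makes (c' ⊖ c)·d the required vector: its coordinates
  -- bridge cells δ apart, so they are short when δ = 0 and below M·p/K otherwise.
  shift⇒result : ∀ c c' δ → c' ≢ c → Shift c c' δ → CellResult d K M
  shift⇒result c c' δ c'≢c (δ<M , shifted) =
    a , (c' ⊖ c , λ i → refl) , ·ᵥ-nonzero p-prime (c' ⊖ c) (⊖≢0 c'≢c) d d≢0 , bounds δ δ<M shifted
    where
    a = (c' ⊖ c) ·ᵥ d
    lifted : ∀ i → toℕ (a i) + toℕ ((c ·ᵥ d) i) ≡ toℕ ((c' ·ᵥ d) i)
                 ⊎ toℕ (a i) + toℕ ((c ·ᵥ d) i) ≡ toℕ ((c' ·ᵥ d) i) + p
    lifted i = %-lift _ _ _ (toℕ<n (a i)) (toℕ<n ((c ·ᵥ d) i)) (·ᵥ-⊖ c' c d i)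
    bounds : ∀ δ → δ < M → (∀ i → q c' i ≡ q c i + δ) →
             (∀ i → toℕ (a i) * K < M * p) ⊎ (∀ i → absp p (a i) * K < p)
    bounds zero    _   shifted = inj₂ λ i →
      same-cell⇒short _ _ _ (toℕ<n (a i)) (lifted i) (sym (trans (shifted i) (+-identityʳ _)))
    bounds (suc δ) δ<M shifted = inj₁ λ i →
      <-≤-trans (shifted-cell⇒small _ _ _ (suc δ) (toℕ<n (a i)) (lifted i) (shifted i) (s≤s z≤n))
                (*-monoˡ-≤ p δ<M)

  short-multiple : CellResult d K M
  short-multiple with pigeonhole few-labels label
  ... | c , c' , c<c' , same with same-label⇒shift c c' same
  ...   | δ , inj₁ shift = shift⇒result c c' δ (≢-sym (<ᶠ⇒≢ c<c')) shift
  ...   | δ , inj₂ shift = shift⇒result c' c δ (<ᶠ⇒≢ c<c') shift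

coordinate-bound : ∀ n₁ a K M p R B .{{_ : NonZero K}} → a * K < M * p → M * R ≤ B * K →
                   p < R ^ suc n₁ → a ^ suc n₁ ≤ B ^ suc n₁ * p ^ n₁
coordinate-bound n₁ a K M p R B aK<Mp MR≤BK p<R^n =
  *-cancelʳ-≤ (a ^ n) (B ^ n * p ^ n₁) (K ^ n) {{m^n≢0 K n}} (begin
    a ^ n * K ^ n            ≡⟨ ^-distribʳ-* a K n ⟨
    (a * K) ^ n              ≤⟨ ^-monoˡ-≤ n (<⇒≤ aK<Mp) ⟩
    (M * p) ^ n              ≡⟨ ^-distribʳ-* M p n ⟩
    M ^ n * (p * p ^ n₁)     ≡⟨ *-assoc (M ^ n) p (p ^ n₁) ⟨
    M ^ n * p * p ^ n₁       ≤⟨ *-monoˡ-≤ (p ^ n₁) (*-monoʳ-≤ (M ^ n) (<⇒≤ p<R^n)) ⟩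
    M ^ n * R ^ n * p ^ n₁   ≡⟨ cong (_* p ^ n₁) (^-distribʳ-* M R n) ⟨
    (M * R) ^ n * p ^ n₁     ≤⟨ *-monoˡ-≤ (p ^ n₁) (^-monoˡ-≤ n MR≤BK) ⟩
    (B * K) ^ n * p ^ n₁     ≡⟨ cong (_* p ^ n₁) (^-distribʳ-* B K n) ⟩
    B ^ n * K ^ n * p ^ n₁   ≡⟨ solve 3 (λ x y z → x :* y :* z := x :* z :* y) refl (B ^ n) (K ^ n) (p ^ n₁) ⟩
    B ^ n * p ^ n₁ * K ^ n   ∎)
  where
  open ≤-Reasoning
  n = suc n₁

short-coordinate-bound : ∀ n₁ b K p t R S E .{{_ : NonZero K}} → b * K < p → R * S ≤ E * K →
                         p < R ^ suc n₁ → t < S ^ n₁ →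
                         b ^ (suc n₁ * n₁) * t ^ suc n₁ ≤ E ^ (suc n₁ * n₁) * p ^ (n₁ * n₁)
short-coordinate-bound n₁ b K p t R S E bK<p RS≤EK p<R^n t<S^n₁ =
  *-cancelʳ-≤ _ _ (K ^ N) {{m^n≢0 K N}} (begin
    b ^ N * t ^ n * K ^ N               ≡⟨ solve 3 (λ x y z → x :* y :* z := x :* z :* y) refl (b ^ N) (t ^ n) (K ^ N) ⟩
    b ^ N * K ^ N * t ^ n               ≡⟨ cong (_* t ^ n) (^-distribʳ-* b K N) ⟨
    (b * K) ^ N * t ^ n                 ≤⟨ *-monoˡ-≤ (t ^ n) (^-monoˡ-≤ N (<⇒≤ bK<p)) ⟩
    p ^ (n₁ + n₁ * n₁) * t ^ n          ≡⟨ cong (_* t ^ n) (trans (^-distribˡ-+-* p n₁ (n₁ * n₁)) (*-comm (p ^ n₁) _)) ⟩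
    p ^ (n₁ * n₁) * p ^ n₁ * t ^ n      ≡⟨ *-assoc (p ^ (n₁ * n₁)) _ _ ⟩
    p ^ (n₁ * n₁) * (p ^ n₁ * t ^ n)    ≤⟨ *-monoʳ-≤ (p ^ (n₁ * n₁)) p^n₁t^n≤[EK]^N ⟩
    p ^ (n₁ * n₁) * (E * K) ^ N         ≡⟨ cong (p ^ (n₁ * n₁) *_) (^-distribʳ-* E K N) ⟩
    p ^ (n₁ * n₁) * (E ^ N * K ^ N)     ≡⟨ solve 3 (λ x y z → x :* (y :* z) := y :* x :* z) refl (p ^ (n₁ * n₁)) (E ^ N) (K ^ N) ⟩
    E ^ N * p ^ (n₁ * n₁) * K ^ N       ∎)
  where
  open ≤-Reasoning
  n = suc n₁
  N = n * n₁
  p^n₁t^n≤[EK]^N : p ^ n₁ * t ^ n ≤ (E * K) ^ N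
  p^n₁t^n≤[EK]^N = begin
    p ^ n₁ * t ^ n                ≤⟨ *-mono-≤ (^-monoˡ-≤ n₁ (<⇒≤ p<R^n)) (^-monoˡ-≤ n (<⇒≤ t<S^n₁)) ⟩
    (R ^ n) ^ n₁ * (S ^ n₁) ^ n   ≡⟨ cong₂ _*_ (^-*-assoc R n n₁) (trans (^-*-assoc S n₁ n) (cong (S ^_) (*-comm n₁ n))) ⟩
    R ^ N * S ^ N                 ≡⟨ ^-distribʳ-* R S N ⟨
    (R * S) ^ N                   ≤⟨ ^-monoˡ-≤ N RS≤EK ⟩
    (E * K) ^ N                   ∎

-- The number of labels A·(2K)^(n-1) is below p, given the size estimates
-- 4nK ≤ RS, 2ntA ≤ 3R, S^(n-1) ≤ 2^(n-1)·t and R^n ≤ 2r^n ≤ 2p: altogether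
-- (2n)^n·t·A·(2K)^(n-1) ≤ 3·2^n·t·p, and n^n ≥ 4 leaves room.
label-count<p : ∀ n₁ t p r R S K A .{{_ : NonZero p}} .{{_ : NonZero t}} → 1 ≤ n₁ →
                4 * suc n₁ * K ≤ R * S → 2 * suc n₁ * t * A ≤ 3 * R → S ^ n₁ ≤ 2 ^ n₁ * t →
                R ^ suc n₁ ≤ 2 * r ^ suc n₁ → r ^ suc n₁ ≤ p → A * (K + K) ^ n₁ < p
label-count<p n₁ t p r R S K A 1≤n₁ 4nK≤RS 2ntA≤3R S^n₁≤2^n₁t R^n≤2r^n r^n≤p =
  *-cancelˡ-< 4 C p (begin-strict
    4 * C          ≤⟨ *-monoˡ-≤ C 4≤n^n ⟩
    n ^ n * C      ≤⟨ *-cancelʳ-≤ (n ^ n * C) (3 * p) (2 ^ n * t) {{m*n≢0 (2 ^ n) t {{m^n≢0 2 n}}}} scaled ⟩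
    3 * p          <⟨ *-monoˡ-< p {3} {4} (n<1+n 3) ⟩
    4 * p          ∎)
  where
  open ≤-Reasoning
  n = suc n₁
  C = A * (K + K) ^ n₁
  4≤n^n : 4 ≤ n ^ n
  4≤n^n = ≤-trans (^-monoˡ-≤ 2 (s≤s 1≤n₁)) (^-monoʳ-≤ n (s≤s 1≤n₁))
  regroup : (2 * n) ^ n * t * C ≡ 2 * n * t * A * (4 * n * K) ^ n₁
  regroup = begin-equality
    (2 * n) ^ n * t * C
      ≡⟨ solve 5 (λ m x t A y → m :* x :* t :* (A :* y) := m :* t :* A :* (x :* y))
               refl (2 * n) ((2 * n) ^ n₁) t A ((K + K) ^ n₁) ⟩
    2 * n * t * A * ((2 * n) ^ n₁ * (K + K) ^ n₁)
      ≡⟨ cong (2 * n * t * A *_) (^-distribʳ-* (2 * n) (K + K) n₁) ⟨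
    2 * n * t * A * (2 * n * (K + K)) ^ n₁
      ≡⟨ cong (λ z → 2 * n * t * A * z ^ n₁) (solve 2 (λ n K → con 2 :* n :* (K :+ K) := con 4 :* n :* K) refl n K) ⟩
    2 * n * t * A * (4 * n * K) ^ n₁   ∎
  scaled : n ^ n * C * (2 ^ n * t) ≤ 3 * p * (2 ^ n * t)
  scaled = begin
    n ^ n * C * (2 ^ n * t)           ≡⟨ solve 4 (λ a C b t → a :* C :* (b :* t) := b :* a :* t :* C) refl (n ^ n) C (2 ^ n) t ⟩
    2 ^ n * n ^ n * t * C             ≡⟨ cong (λ z → z * t * C) (^-distribʳ-* 2 n n) ⟨
    (2 * n) ^ n * t * C               ≡⟨ regroup ⟩
    2 * n * t * A * (4 * n * K) ^ n₁  ≤⟨ *-mono-≤ 2ntA≤3R (^-monoˡ-≤ n₁ 4nK≤RS) ⟩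
    3 * R * (R * S) ^ n₁              ≡⟨ cong (3 * R *_) (^-distribʳ-* R S n₁) ⟩
    3 * R * (R ^ n₁ * S ^ n₁)         ≡⟨ solve 3 (λ R x y → con 3 :* R :* (x :* y) := con 3 :* (R :* x) :* y) refl R (R ^ n₁) (S ^ n₁) ⟩
    3 * R ^ n * S ^ n₁                ≤⟨ *-mono-≤ (*-monoʳ-≤ 3 R^n≤2r^n) S^n₁≤2^n₁t ⟩
    3 * (2 * r ^ n) * (2 ^ n₁ * t)    ≡⟨ solve 3 (λ x y t → con 3 :* (con 2 :* x) :* (y :* t) := con 3 :* x :* (con 2 :* y :* t)) refl (r ^ n) (2 ^ n₁) t ⟩
    3 * r ^ n * (2 ^ n * t)           ≤⟨ *-monoˡ-≤ (2 ^ n * t) (*-monoʳ-≤ 3 r^n≤p) ⟩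
    3 * p * (2 ^ n * t)               ∎

record Parameters (n t R S : ℕ) : Set where
  field
    K M A      : ℕ
    K≢0        : NonZero K
    M≢0        : NonZero M
    K≤AM       : K ≤ A * M
    RS≤8nK     : R * S ≤ 8 * n * K
    4nK≤RS     : 4 * n * K ≤ R * S
    MR≤2ntK    : M * R ≤ 2 * n * t * K
    2ntA≤3R    : 2 * n * t * A ≤ 3 * R

<ceil : ∀ x E .{{_ : NonZero E}} → x < E * suc (x / E)
<ceil x E = subst (x <_) (trans (+-comm (x / E * E) E) (trans (cong (E +_) (*-comm (x / E) E)) (sym (*-suc E (x / E)))))
                  (m<[m/n]*n+n x E)

ceil≤2* : ∀ x E .{{_ : NonZero E}} → E ≤ x → E * suc (x / E) ≤ 2 * x
ceil≤2* x E E≤x = begin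
  E * suc (x / E)    ≡⟨ *-suc E (x / E) ⟩
  E + E * (x / E)    ≤⟨ +-mono-≤ E≤x (subst (_≤ x) (*-comm (x / E) E) (m/n*n≤m x E)) ⟩
  x + x              ≡⟨ cong (x +_) (+-identityʳ x) ⟨
  2 * x              ∎
  where open ≤-Reasoning

block-count-bound : ∀ A B K M R → 1 ≤ M → B ≤ R → B * K < M * R + R → A * M ≤ K + M → B * A ≤ 3 * R
block-count-bound A B K M R 1≤M B≤R BK<MR+R AM≤K+M = <⇒≤ (*-cancelʳ-< M (B * A) (3 * R) (begin-strict
  B * A * M          ≡⟨ *-assoc B A M ⟩
  B * (A * M)        ≤⟨ *-monoʳ-≤ B AM≤K+M ⟩
  B * (K + M)        ≡⟨ *-distribˡ-+ B K M ⟩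
  B * K + B * M      <⟨ +-monoˡ-< (B * M) BK<MR+R ⟩
  M * R + R + B * M  ≤⟨ +-mono-≤ (+-monoʳ-≤ (M * R) R≤MR) (*-mono-≤ B≤R (≤-reflexive refl)) ⟩
  M * R + M * R + R * M  ≡⟨ solve 2 (λ M R → M :* R :+ M :* R :+ R :* M := con 3 :* R :* M) refl M R ⟩
  3 * R * M          ∎))
  where
  open ≤-Reasoning
  R≤MR : R ≤ M * R
  R≤MR = subst (_≤ M * R) (*-identityˡ R) (*-monoˡ-≤ R 1≤M)

-- Such parameters exist: K = ⌊RS/8n⌋ + 1, M = ⌊2ntK/R⌋ (positive, as R ≤ 2ntK) and A = ⌊K/M⌋ + 1.
parameters : ∀ n t R S → 1 ≤ n → 2 ≤ t → 2 ≤ S → 2 * n * t < R → Parameters n t R S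
parameters n@(suc _) t R S _ 2≤t 2≤S B<R = record
  { K = K ; M = M ; A = A ; K≢0 = _ ; M≢0 = M≢0 ; K≤AM = K≤AM
  ; RS≤8nK = <⇒≤ RS<8nK ; 4nK≤RS = 4nK≤RS ; MR≤2ntK = m/n*n≤m (B * K) R
  ; 2ntA≤3R = block-count-bound A B K M R (>-nonZero⁻¹ M) (<⇒≤ B<R)
                (m<[m/n]*n+n (B * K) R) AM≤K+M }
  where
  open ≤-Reasoning
  B = 2 * n * t
  K = suc (R * S / (8 * n))
  instance
    R≢0 : NonZero R
    R≢0 = >-nonZero (≤-<-trans z≤n B<R)
  4n≤B : 4 * n ≤ B
  4n≤B = subst (_≤ B) (solve 1 (λ n → con 2 :* n :* con 2 := con 4 :* n) refl n) (*-monoʳ-≤ (2 * n) 2≤t)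
  RS<8nK : R * S < 8 * n * K
  RS<8nK = <ceil (R * S) (8 * n)
  4nK≤RS : 4 * n * K ≤ R * S
  4nK≤RS = *-cancelˡ-≤ 2 (begin
    2 * (4 * n * K)  ≡⟨ solve 2 (λ n K → con 2 :* (con 4 :* n :* K) := con 8 :* n :* K) refl n K ⟩
    8 * n * K        ≤⟨ ceil≤2* (R * S) (8 * n) (begin
                          8 * n      ≡⟨ solve 1 (λ n → con 8 :* n := con 4 :* n :* con 2) refl n ⟩
                          4 * n * 2  ≤⟨ *-mono-≤ (≤-trans 4n≤B (<⇒≤ B<R)) 2≤S ⟩
                          R * S      ∎) ⟩
    2 * (R * S)      ∎)
  R≤BK : R ≤ B * K
  R≤BK = ≤-trans (<⇒≤ (*-cancelˡ-< 2 R (4 * n * K) (begin-strict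
    2 * R            ≡⟨ *-comm 2 R ⟩
    R * 2            ≤⟨ *-monoʳ-≤ R 2≤S ⟩
    R * S            <⟨ RS<8nK ⟩
    8 * n * K        ≡⟨ solve 2 (λ n K → con 8 :* n :* K := con 2 :* (con 4 :* n :* K)) refl n K ⟩
    2 * (4 * n * K)  ∎))) (*-monoˡ-≤ K 4n≤B)
  M = B * K / R
  instance
    M≢0 : NonZero M
    M≢0 = >-nonZero (m≥n⇒m/n>0 R≤BK)
  A = suc (K / M)
  K≤AM : K ≤ A * M
  K≤AM = <⇒≤ (subst (K <_) (*-comm M A) (<ceil K M))
  AM≤K+M : A * M ≤ K + M
  AM≤K+M = subst (A * M ≤_) (+-comm M K) (+-monoʳ-≤ M (m/n*n≤m K M))

GoodPoint : (n t p : ℕ) .{{_ : NonZero p}} → ZpVec p n → Set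
GoodPoint n t p d = ∃ λ (a : ZpVec p n) → InLine d a × NonzeroVec a ×
  ((∀ (i : Fin n) → toℕ (a i) ^ n ≤ (2 * n * t) ^ n * p ^ (n ∸ 1))
  ⊎ (∀ (i : Fin n) → absp p (a i) ^ (n * (n ∸ 1)) * t ^ n
                       ≤ (8 * n) ^ (n * (n ∸ 1)) * p ^ ((n ∸ 1) * (n ∸ 1))))

InLine-refl : ∀ {p n} .{{_ : NonZero p}} → 1 < p → (d : ZpVec p n) → InLine d d
InLine-refl {p} 1<p d = one , λ i → toℕ-injective (sym (begin
  toℕ ((one ·ᵥ d) i)            ≡⟨ toℕ-mod (toℕ one * toℕ (d i)) ⟩
  (toℕ one * toℕ (d i)) % p     ≡⟨ cong (λ z → (z * toℕ (d i)) % p) (toℕ-fromℕ< 1<p) ⟩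
  (1 * toℕ (d i)) % p           ≡⟨ cong (_% p) (*-identityˡ (toℕ (d i))) ⟩
  toℕ (d i) % p                 ≡⟨ toℕ-% (d i) ⟩
  toℕ (d i)                     ∎))
  where
  open ≡-Reasoning
  one = fromℕ< 1<p

small-p : ∀ n₁ t p .{{_ : NonZero p}} → Prime p → (d : ZpVec p (suc n₁)) → NonzeroVec d →
          p ≤ (2 * suc n₁ * t) ^ suc n₁ → GoodPoint (suc n₁) t p d
small-p n₁ t p p-prime d d≢0 p≤B^n =
  d , InLine-refl (nonTrivial⇒n>1 p {{prime⇒nonTrivial p-prime}}) d , d≢0 , inj₁ λ i → begin
    toℕ (d i) ^ suc n₁                  ≤⟨ ^-monoˡ-≤ (suc n₁) (<⇒≤ (toℕ<n (d i))) ⟩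
    p * p ^ n₁                          ≤⟨ *-monoˡ-≤ (p ^ n₁) p≤B^n ⟩
    (2 * suc n₁ * t) ^ suc n₁ * p ^ n₁  ∎
  where open ≤-Reasoning

-- Large primes, p > (2nt)^n: with R = ⌊p^(1/n)⌋ + 1 > 2nt and S = ⌊t^(1/(n-1))⌋ + 1 ≥ 2,
-- run the pigeonhole with the chosen parameters and convert its two alternatives.
large-p : ∀ n₁ t p → 1 ≤ n₁ → 2 ≤ t → .{{_ : NonZero p}} → Prime p →
          (d : ZpVec p (suc n₁)) → NonzeroVec d → (2 * suc n₁ * t) ^ suc n₁ < p →
          GoodPoint (suc n₁) t p d
large-p n₁@(suc _) t p 1≤n₁ 2≤t p-prime d d≢0 B^n<p with iroot (suc n₁) p | iroot n₁ t
... | r , r^n≤p , p<R^n | s , s^n₁≤t , t<S^n₁ =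
  convert (Pigeonhole.short-multiple p-prime d d≢0 K M A K≤AM
             (label-count<p n₁ t p r R S K A 1≤n₁ 4nK≤RS 2ntA≤3R S^n₁≤2^n₁t R^n≤2r^n r^n≤p))
  where
  n = suc n₁
  B = 2 * n * t
  R = suc r
  S = suc s
  instance
    t≢0 : NonZero t
    t≢0 = >-nonZero (≤-trans (s≤s z≤n) 2≤t)
  B<R : B < R
  B<R = ≰⇒> (λ R≤B → <⇒≱ (<-trans B^n<p p<R^n) (^-monoˡ-≤ n R≤B))
  1≤s : 1 ≤ s
  1≤s = root-positive t s n₁ 2≤t t<S^n₁
  open Parameters (parameters n t R S (s≤s z≤n) 2≤t (s≤s 1≤s) B<R)
  instance
    K≢0′ : NonZero K
    K≢0′ = K≢0
    M≢0′ : NonZero M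
    M≢0′ = M≢0
  S^n₁≤2^n₁t : S ^ n₁ ≤ 2 ^ n₁ * t
  S^n₁≤2^n₁t = ≤-trans ([1+s]^k≤2^k*s^k s n₁ 1≤s) (*-monoʳ-≤ (2 ^ n₁) s^n₁≤t)
  R^n≤2r^n : R ^ n ≤ 2 * r ^ n
  R^n≤2r^n = [1+r]^n≤2r^n n r (≤-trans (m≤m*n (2 * n) t) (s≤s⁻¹ B<R))
  convert : CellResult d K M → GoodPoint n t p d
  convert (a , on-line , a≢0 , inj₁ small) = a , on-line , a≢0 , inj₁ λ i →
    coordinate-bound n₁ (toℕ (a i)) K M p R B (small i) MR≤2ntK p<R^n
  convert (a , on-line , a≢0 , inj₂ short) = a , on-line , a≢0 , inj₂ λ i →
    short-coordinate-bound n₁ (absp p (a i)) K p t R S (8 * n) (short i) RS≤8nK p<R^n t<S^n₁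

lemma11 : (n t p : ℕ) → 2 ≤ n → 2 ≤ t → .{{_ : NonZero p}} → Prime p →
          (d : ZpVec p n) → NonzeroVec d →
          ∃ λ (a : ZpVec p n) → InLine d a × NonzeroVec a ×
            ((∀ (i : Fin n) → toℕ (a i) ^ n ≤ (2 * n * t) ^ n * p ^ (n ∸ 1))
            ⊎ (∀ (i : Fin n) → absp p (a i) ^ (n * (n ∸ 1)) * t ^ n
                                 ≤ (8 * n) ^ (n * (n ∸ 1)) * p ^ ((n ∸ 1) * (n ∸ 1))))
lemma11 (suc n₁) t p (s≤s 1≤n₁) 2≤t p-prime d d≢0 with p ≤? (2 * suc n₁ * t) ^ suc n₁
... | yes p≤[2nt]^n = small-p n₁ t p p-prime d d≢0 p≤[2nt]^n
... | no  p≰[2nt]^n = large-p n₁ t p 1≤n₁ 2≤t p-prime d d≢0 (≰⇒> p≰[2nt]^n)
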